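{- Let $m,n,r$ be positive integers with $m,n$ coprime and $\mathbf w$ a weak composition of $m$ with $r$ parts. The map $\mathcal A_{\mathbf w}$ is a well-defined, weight-preserving bijection from $\mathrm{SSPF}_{\mathbf w}(m,n)$ onto the set of $n$-stable $(m,r)$-affine compositions of weight $\mathbf w$. (For $r=m$, $\mathbf w=(1^m)$, it is the inverse of the Gorsky–Mazin–Vazirani bijection between $n$-stable affine permutations and $(m,n)$-parking functions.)
   Context: An $(m,n)$-Dyck path $\mathsf D$ is a lattice path from $(0,m)$ to $(n,0)$ of unit south and east steps staying weakly below the line $mx+ny=mn$. Its vertical steps are $v_0,\dots,v_{m-1}$ from top to bottom; $v_j$ has top endpoint $(a_j,m-j)$, identified with $v_j$. Steps $v_j,v_{j+1}$ are consecutive if $a_j=a_{j+1}$. The Anderson label is $\gamma(x,y)=mn-mx-ny$. A rank $r$ semistandard $(m,n)$-parking function is $(\mathsf D,\Upsilon)$ with $\Upsilon:\{v_0,\dots,v_{m-1}\}\to\{1,\dots,r\}$ and $\Upsilon(v_j)\le\Upsilon(v_{j+1})$ for consecutive steps; its weight is $(|\Upsilon^{ -1}(1)|,\dots,|\Upsilon^{ -1}(r)|)$; $\mathrm{SSPF}_{\mathbf w}(m,n)$ is the set of those of weight $\mathbf w$. An $(m,r)$-affine composition is $f:\mathbb Z\to\mathbb Z$ with $f(x+m)=f(x)+r$ for all $x$, such that $f^{ -1}([1,r])$ has exactly $m$ elements, pairwise distinct mod $m$, with sum $m(m+1)/2$; weight $(|f^{ -1}(1)|,\dots,|f^{ -1}(r)|)$;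 $n$-stable if $f(x+n)\ge f(x)$ for all $x$. The map $\mathcal A_{\mathbf w}$: for $(\mathsf D,\Upsilon)\in\mathrm{SSPF}_{\mathbf w}(m,n)$ define $\tilde f(\gamma(v_j)+pm)=\Upsilon(v_j)+pr$ for $p\in\mathbb Z$, $0\le j\le m-1$; let $k\in\mathbb Z$ satisfy $\sum_{j=0}^{m-1}(\gamma(v_j)-(j+1))=km$; set $\mathcal A_{\mathbf w}(\mathsf D,\Upsilon)(x)=\tilde f(x+k)$. -}

module Defs where

open import Data.Nat as ℕ using (ℕ; zero; suc; _∸_)
open import Data.Integer as ℤ using (ℤ; +_; _-_; _+_; _*_; _≤_)
open import Data.Integer.Divisibility using (_∣_)
open import Data.Fin using (Fin; toℕ)
open import Data.List using (List; []; _∷_; length; take; filter; map; allFin; foldr)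
open import Data.List.Membership.Propositional using (_∈_)
open import Data.List.Relation.Unary.AllPairs using (AllPairs)
open import Data.Product using (Σ; Σ-syntax; _×_)
open import Relation.Binary.PropositionalEquality using (_≡_; _≢_)
open import Relation.Nullary using (¬_)
open import Function.Bundles using (_⇔_)

data Step : Set where
  S E : Step

countS : List Step → ℕ
countS []      = 0
countS (S ∷ w) = suc (countS w)
countS (E ∷ w) = countS w

countE : List Step → ℕ
countE []      = 0
countE (S ∷ w) = countE w
countE (E ∷ w) = suc (countE w)

-- A path from (0,m) to (n,0) given by its sequence of steps; after a
-- prefix p the current point is (countE p , m ∸ countS p).
-- It stays weakly below the line m x + n y = m n.
IsDyck : ℕ → ℕ → List Step → Set
IsDyck m n path =
  countS path ≡ m × countE path ≡ n ×
  (∀ k → m ℕ.* countE (take k path) ℕ.+ n ℕ.* (m ∸ countS (take k path)) ℕ.≤ m ℕ.* n)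

-- eastBefore path j = number of east steps preceding the j-th (0-indexed)
-- south step, i.e. a_j, the x-coordinate of the vertical step v_j.
eastBefore : List Step → ℕ → ℕ
eastBefore []      j       = 0
eastBefore (S ∷ w) zero    = 0
eastBefore (S ∷ w) (suc j) = eastBefore w j
eastBefore (E ∷ w) j       = suc (eastBefore w j)

record SSPF (m n r : ℕ) : Set where
  field
    path    : List Step
    isDyck  : IsDyck m n path
    Υ       : Fin m → ℕ
    Υ-range : ∀ j → 1 ℕ.≤ Υ j × Υ j ℕ.≤ r
    Υ-mono  : ∀ (i j : Fin m) → toℕ j ≡ suc (toℕ i) →
              eastBefore path (toℕ i) ≡ eastBefore path (toℕ j) → Υ i ℕ.≤ Υ j

open SSPF public

aCoord : ∀ {m n r} → SSPF m n r → Fin m → ℕ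
aCoord P j = eastBefore (path P) (toℕ j)

-- weight: i ↦ |Υ⁻¹(i+1)|  (i : Fin r stands for the value i+1 ∈ {1..r})
sspfWeight : ∀ {m n r} → SSPF m n r → Fin r → ℕ
sspfWeight {m} P i = length (filter (λ j → Υ P j ℕ.≟ suc (toℕ i)) (allFin m))

_≈SSPF_ : ∀ {m n r} → SSPF m n r → SSPF m n r → Set
P ≈SSPF Q = path P ≡ path Q × (∀ j → Υ P j ≡ Υ Q j)

-- Anderson label γ(x,y) = mn - mx - ny, evaluated at v_j = (a_j, m - j)

sumℤ : List ℤ → ℤ
sumℤ = foldr _+_ (+ 0)

γv : ∀ {m n r} → SSPF m n r → Fin m → ℤ
γv {m} {n} P j = + m * + n - + m * + aCoord P j - + n * (+ m - + toℕ j)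

DistinctMod : ℕ → ℤ → ℤ → Set
DistinctMod m x y = ¬ (+ m ∣ (x - y))

IsAffineComp : ℕ → ℕ → (ℤ → ℤ) → Set
IsAffineComp m r f =
  (∀ x → f (x + + m) ≡ f x + + r) ×
  Σ[ L ∈ List ℤ ]
    ( length L ≡ m
    × AllPairs (DistinctMod m) L
    × (∀ x → ((+ 1 ≤ f x × f x ≤ + r) ⇔ x ∈ L))
    × + 2 * sumℤ L ≡ + m * + (suc m) )

HasWeight : ∀ {r} → (ℤ → ℤ) → (Fin r → ℕ) → Set
HasWeight {r} f w =
  ∀ (i : Fin r) → Σ[ L ∈ List ℤ ]
    ( length L ≡ w i
    × AllPairs _≢_ L
    × (∀ x → (f x ≡ + suc (toℕ i)) ⇔ x ∈ L) )

NStable : ℕ → (ℤ → ℤ) → Set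
NStable n f = ∀ x → f x ≤ f (x + + n)

-- The map 𝒜_w, as the relation "f = 𝒜_w(P)":
--   k is the integer with  m k = Σ_j (γ(v_j) - (j+1)),  and
--   f(x) = f̃(x + k) where f̃(γ(v_j) + p m) = Υ(v_j) + p r,
-- i.e.  f(γ(v_j) + p m - k) = Υ(v_j) + p r  for all j, p.
IsA : ∀ {m n r} → SSPF m n r → (ℤ → ℤ) → Set
IsA {m} {n} {r} P f =
  Σ[ k ∈ ℤ ]
    ( + m * k ≡ sumℤ (map (λ j → γv P j - + suc (toℕ j)) (allFin m))
    × (∀ (j : Fin m) (p : ℤ) → f (γv P j + p * + m - k) ≡ + Υ P j + p * + r) )

-- Since m and n are coprime, every integer is uniquely n j + q m with 0 ≤ j < m, and the
-- Anderson label of v_j is γ(v_j) = n j − m a_j.  Hence 𝒜(P) is the function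
-- f(n j + q m − k) = Υ(v_j) + (q + a_j) r.  It is (m,r)-periodic, takes values in [1,r]
-- exactly at the m points γ(v_j) − k, whose sum the choice of k makes m(m+1)/2, and
-- f(x) ≤ f(x + n) amounts to (a_j, Υ(v_j)) weakly increasing from each vertical step to
-- the next, i.e. to the Dyck and semistandard conditions.  Conversely, given an n-stable
-- f, let −k be the least point of the window f⁻¹[1,r] and a_j the number of periods by
-- which f(n j − k) exceeds the window.  Stability gives 0 = a_0 ≤ a_1 ≤ … ≤ a_m = n,
-- minimality of −k puts the path below the diagonal, and the window sum of f recovers
-- the equation defining k.

module Submission where

open import Data.Nat as ℕ using (ℕ; zero; suc; z≤n; s≤s)
import Data.Nat.Properties as ℕP
open import Data.Nat.ListAction using (sum)
open import Data.Nat.Coprimality using (Coprime; coprime-Bézout; coprime-divisor)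
open import Data.Nat.GCD using (module Bézout)
import Data.Nat.Divisibility as ℕD
open import Data.Integer as ℤ using (ℤ; +_; -[1+_]; _+_; _*_; _-_; -_; _≤_; ∣_∣; +≤+; _/ℕ_; _%ℕ_)
import Data.Integer.Properties as ℤP
open import Data.Integer.Divisibility.Signed using (divides; ∣ᵤ⇒∣)
open import Data.Integer.Divisibility using () renaming (_∣_ to _∣ℤᵤ_)
open import Data.Integer.DivMod using (a≡a%ℕn+[a/ℕn]*n; n%ℕd<d)
open import Data.Integer.Tactic.RingSolver using (solve-∀)
open import Algebra.Bundles using (AbelianGroup)
open import Algebra.Properties.Group (AbelianGroup.group ℤP.+-0-abelianGroup) using () renaming (∙-cancelˡ to +-cancelˡ)
open import Data.Fin as F using (Fin; toℕ; fromℕ<)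
import Data.Fin.Properties as FP
open import Data.List using (List; []; _∷_; _++_; length; map; tabulate; allFin; filter; take)
import Data.List.Properties as LP
open import Data.List.Membership.Propositional using (_∈_; _∉_)
open import Data.List.Membership.Propositional.Properties using (∈-∃++; ∈-map⁺; ∈-map⁻; ∈-filter⁺; ∈-filter⁻; ∈-allFin)
open import Data.List.Relation.Unary.Any using (here; there)
open import Data.List.Relation.Unary.All as All using (All; []; _∷_)
open import Data.List.Relation.Unary.AllPairs as AllPairs using (AllPairs; []; _∷_)
import Data.List.Relation.Unary.AllPairs.Properties as AllPairsP
open import Data.List.Relation.Unary.Unique.Propositional using (Unique)
open import Data.List.Relation.Unary.Unique.Propositional.Properties using (allFin⁺)
open import Data.List.Relation.Binary.Permutation.Propositional as ↭ using (_↭_; ↭-sym)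
open import Data.List.Relation.Binary.Permutation.Propositional.Properties using (All-resp-↭; ∈-resp-↭; shift; ↭-length)
open import Data.List.Extrema ℤP.≤-totalOrder using (min; argmin-sel; min≤⊤; min≤xs)
open import Data.Product using (Σ; Σ-syntax; _×_; _,_; proj₁; proj₂)
open import Data.Sum using (_⊎_; inj₁; inj₂)
open import Relation.Nullary using (Dec; yes; no)
open import Data.Empty using (⊥-elim)
open import Relation.Binary.PropositionalEquality
open import Function using (_∘_)
open import Function.Bundles using (_⇔_; mk⇔; Equivalence)
open import Defs

-+-cancel : ∀ x k → x - k + k ≡ x
-+-cancel = solve-∀

+--cancel : ∀ x k → x + k - k ≡ x
+--cancel = solve-∀

window-offset-nonneg : ∀ {u v : ℤ} {r : ℕ} c → + 1 ≤ u → v ≤ + r → u ≤ v + c * + r → + 0 ≤ c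
window-offset-nonneg (+ _)    _   _   _       = +≤+ z≤n
window-offset-nonneg {u} {v} {r} -[1+ c ] 1≤u v≤r u≤v-r = ⊥-elim (ℕP.1+n≰n (ℤP.drop‿+≤+ (begin
  + 1                     ≤⟨ 1≤u ⟩
  u                       ≤⟨ u≤v-r ⟩
  v + -[1+ c ] * + r      ≤⟨ ℤP.+-monoˡ-≤ (-[1+ c ] * + r) v≤r ⟩
  + r + -[1+ c ] * + r    ≡⟨ collapse (+ r) (+ c) ⟩
  - (+ c * + r)           ≡⟨ cong -_ (ℤP.pos-* c r) ⟨
  - + (c ℕ.* r)           ≤⟨ ℤP.neg-≤-pos ⟩
  + 0                     ∎)))
  where
  open ℤP.≤-Reasoning
  collapse : ∀ r c → r + (- (+ 1 + c)) * r ≡ - (c * r)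
  collapse = solve-∀

window-offset-zero : ∀ {u v : ℤ} {r : ℕ} c → + 1 ≤ u → u ≤ + r → + 1 ≤ v → v ≤ + r →
                     u ≡ v + c * + r → c ≡ + 0
window-offset-zero {u} {v} {r} c 1≤u u≤r 1≤v v≤r u≡v+cr = ℤP.≤-antisym c≤0 0≤c
  where
  transpose : ∀ u v c r → u ≡ v + c * r → v ≡ u + (- c) * r
  transpose u v c r refl = sym (cancel v c r)
    where
    cancel : ∀ v c r → v + c * r + (- c) * r ≡ v
    cancel = solve-∀
  0≤c : + 0 ≤ c
  0≤c = window-offset-nonneg c 1≤u v≤r (ℤP.≤-reflexive u≡v+cr)
  c≤0 : c ≤ + 0
  c≤0 = subst (_≤ + 0) (ℤP.neg-involutive c) (ℤP.neg-mono-≤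
          (window-offset-nonneg (- c) 1≤v u≤r (ℤP.≤-reflexive (transpose u v c (+ r) u≡v+cr))))

-- Residues modulo m

module Residues (m′ n : ℕ) (cop : Coprime (suc m′) n) where

  m : ℕ
  m = suc m′

  inverse : Σ ℤ λ u → Σ ℤ λ t → + n * u ≡ + 1 + + m * t
  inverse with coprime-Bézout cop
  ... | Bézout.+- x y 1+yn≡xm = - + y , - + x , (begin
    + n * - + y               ≡⟨ rearrange (+ n) (+ y) ⟩
    + 1 - (+ 1 + + y * + n)   ≡⟨ cong (λ z → + 1 - z) (lift 1+yn≡xm) ⟩
    + 1 - + x * + m           ≡⟨ rearrange′ (+ x) (+ m) ⟩
    + 1 + + m * - + x         ∎)
    where
    open ≡-Reasoning
    rearrange : ∀ n y → n * (- y) ≡ + 1 - (+ 1 + y * n)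
    rearrange = solve-∀
    rearrange′ : ∀ x m → + 1 - x * m ≡ + 1 + m * (- x)
    rearrange′ = solve-∀
    lift : 1 ℕ.+ y ℕ.* n ≡ x ℕ.* m → + 1 + + y * + n ≡ + x * + m
    lift e = trans (cong (λ z → + 1 + z) (sym (ℤP.pos-* y n)))
               (trans (sym (ℤP.pos-+ 1 (y ℕ.* n))) (trans (cong +_ e) (ℤP.pos-* x m)))
  ... | Bézout.-+ x y 1+xm≡yn = + y , + x , (begin
    + n * + y          ≡⟨ ℤP.pos-* n y ⟨
    + (n ℕ.* y)        ≡⟨ cong +_ (trans (ℕP.*-comm n y) (sym 1+xm≡yn)) ⟩
    + (1 ℕ.+ x ℕ.* m)  ≡⟨ ℤP.pos-+ 1 (x ℕ.* m) ⟩
    + 1 + + (x ℕ.* m)  ≡⟨ cong (λ z → + 1 + + z) (ℕP.*-comm x m) ⟩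
    + 1 + + (m ℕ.* x)  ≡⟨ cong (λ z → + 1 + z) (ℤP.pos-* m x) ⟩
    + 1 + + m * + x    ∎)
    where open ≡-Reasoning

  private
    u t : ℤ
    u = proj₁ inverse
    t = proj₁ (proj₂ inverse)

  decompose : ∀ y → Σ (Fin m) λ j → Σ ℤ λ q → y ≡ + n * + toℕ j + q * + m
  decompose y = fromℕ< (n%ℕd<d (y * u) m) , + n * D - y * t , (begin
    y                                          ≡⟨ expand ⟩
    + n * (y * u) - y * t * + m                ≡⟨ cong (λ z → + n * z - y * t * + m) (a≡a%ℕn+[a/ℕn]*n (y * u) m) ⟩
    + n * (+ X + D * + m) - y * t * + m        ≡⟨ collect (+ n) (+ X) D (+ m) y t ⟩
    + n * + X + (+ n * D - y * t) * + m        ≡⟨ cong (λ z → + n * + z + (+ n * D - y * t) * + m)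
                                                       (FP.toℕ-fromℕ< (n%ℕd<d (y * u) m)) ⟨
    + n * + toℕ (fromℕ< (n%ℕd<d (y * u) m)) + (+ n * D - y * t) * + m ∎)
    where
    open ≡-Reasoning
    X : ℕ
    X = (y * u) %ℕ m
    D : ℤ
    D = (y * u) /ℕ m
    expand : y ≡ + n * (y * u) - y * t * + m
    expand = begin
      y                               ≡⟨ unit y (+ m * t) ⟩
      y * (+ 1 + + m * t) - y * (+ m * t) ≡⟨ cong (λ z → y * z - y * (+ m * t)) (proj₂ (proj₂ inverse)) ⟨
      y * (+ n * u) - y * (+ m * t)   ≡⟨ reorder y (+ n) u (+ m) t ⟩
      + n * (y * u) - y * t * + m     ∎
      where
      unit : ∀ y s → y ≡ y * (+ 1 + s) - y * s
      unit = solve-∀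
      reorder : ∀ y n u m t → y * (n * u) - y * (m * t) ≡ n * (y * u) - y * t * m
      reorder = solve-∀
    collect : ∀ n x d m y t → n * (x + d * m) - y * t * m ≡ n * x + (n * d - y * t) * m
    collect = solve-∀

  private
    divisible-and-small⇒0 : ∀ {d} → m ℕD.∣ d → d ℕ.< m → d ≡ 0
    divisible-and-small⇒0 {zero}  _   _   = refl
    divisible-and-small⇒0 {suc _} m∣d d<m = ⊥-elim (ℕP.<⇒≱ d<m (ℕD.∣⇒≤ m∣d))

    residue-unique-≤ : ∀ {i j} q q′ → i ℕ.< m → j ℕ.≤ i →
                       + n * + i + q * + m ≡ + n * + j + q′ * + m → i ≡ j
    residue-unique-≤ {i} {j} q q′ i<m j≤i e = begin
      i             ≡⟨ ℕP.m+[n∸m]≡n j≤i ⟨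
      j ℕ.+ d       ≡⟨ cong (j ℕ.+_) (divisible-and-small⇒0 m∣d (ℕP.≤-<-trans (ℕP.m∸n≤m i j) i<m)) ⟩
      j ℕ.+ 0       ≡⟨ ℕP.+-identityʳ j ⟩
      j             ∎
      where
      open ≡-Reasoning
      d : ℕ
      d = i ℕ.∸ j
      difference : ∀ n j d q q′ m → n * (j + d) + q * m ≡ n * j + q′ * m → n * d ≡ (q′ - q) * m
      difference n j d q q′ m e = trans (isolate n j d q m) (trans (cong (λ z → z - q * m - n * j) e) (collect n j q q′ m))
        where
        isolate : ∀ n j d q m → n * d ≡ n * (j + d) + q * m - q * m - n * j
        isolate = solve-∀
        collect : ∀ n j q q′ m → n * j + q′ * m - q * m - n * j ≡ (q′ - q) * m
        collect = solve-∀
      nd≡ : + n * + d ≡ (q′ - q) * + m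
      nd≡ = difference (+ n) (+ j) (+ d) q q′ (+ m)
              (subst (λ z → + n * z + q * + m ≡ + n * + j + q′ * + m)
                     (trans (cong +_ (sym (ℕP.m+[n∸m]≡n j≤i))) (ℤP.pos-+ j d)) e)
      m∣d : m ℕD.∣ d
      m∣d = coprime-divisor cop (ℕD.divides ∣ q′ - q ∣
              (trans (cong ∣_∣ (ℤP.pos-* n d)) (trans (cong ∣_∣ nd≡) (ℤP.abs-* (q′ - q) (+ m)))))

  decompose-unique : ∀ {i j} q q′ → + n * + toℕ i + q * + m ≡ + n * + toℕ j + q′ * + m → i ≡ j × q ≡ q′
  decompose-unique {i} {j} q q′ e = i≡j , ℤP.*-cancelʳ-≡ q q′ (+ m) (+-cancelˡ (+ n * + toℕ j) _ _
    (subst (λ k → + n * + toℕ k + q * + m ≡ + n * + toℕ j + q′ * + m) i≡j e))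
    where
    i≡j : i ≡ j
    i≡j with ℕP.≤-total (toℕ j) (toℕ i)
    ... | inj₁ j≤i = FP.toℕ-injective (residue-unique-≤ q q′ (FP.toℕ<n i) j≤i e)
    ... | inj₂ i≤j = FP.toℕ-injective (sym (residue-unique-≤ q′ q (FP.toℕ<n j) i≤j (sym e)))

sumFin : ∀ {k} → (Fin k → ℤ) → ℤ
sumFin f = sumℤ (tabulate f)

sumℤ-map-allFin : ∀ {k} (f : Fin k → ℤ) → sumℤ (map f (allFin k)) ≡ sumFin f
sumℤ-map-allFin f = cong sumℤ (LP.map-tabulate (λ j → j) f)

sumFin-cong : ∀ {k} {f g : Fin k → ℤ} → (∀ j → f j ≡ g j) → sumFin f ≡ sumFin g
sumFin-cong f≗g = cong sumℤ (LP.tabulate-cong f≗g)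

sumFin-- : ∀ {k} (f g : Fin k → ℤ) → sumFin (λ j → f j - g j) ≡ sumFin f - sumFin g
sumFin-- {zero}  f g = refl
sumFin-- {suc k} f g = trans (cong (λ s → (f F.zero - g F.zero) + s) (sumFin-- (f ∘ F.suc) (g ∘ F.suc)))
                             (interchange (f F.zero) (g F.zero) _ _)
  where
  interchange : ∀ a b c d → (a - b) + (c - d) ≡ (a + c) - (b + d)
  interchange = solve-∀

sumFin-*ˡ : ∀ {k} (c : ℤ) (f : Fin k → ℤ) → sumFin (λ j → c * f j) ≡ c * sumFin f
sumFin-*ˡ {zero}  c f = sym (ℤP.*-zeroʳ c)
sumFin-*ˡ {suc k} c f = trans (cong (λ s → c * f F.zero + s) (sumFin-*ˡ c (f ∘ F.suc)))
                              (sym (ℤP.*-distribˡ-+ c (f F.zero) _))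

sumFin-const : ∀ {k} (c : ℤ) → sumFin {k} (λ _ → c) ≡ + k * c
sumFin-const {zero}  c = refl
sumFin-const {suc k} c = trans (cong (λ s → c + s) (sumFin-const {k} c)) (distrib (+ k) c)
  where
  distrib : ∀ k c → c + k * c ≡ (+ 1 + k) * c
  distrib = solve-∀

sumFin-arithmetic : ∀ k (c : ℤ) → + 2 * sumFin {k} (λ j → c + + toℕ j) ≡ + k * (+ 2 * c + + k - + 1)
sumFin-arithmetic zero    c = refl
sumFin-arithmetic (suc k) c = begin
  + 2 * (c + + 0 + sumFin {k} (λ j → c + + suc (toℕ j)))
    ≡⟨ cong (λ s → + 2 * (c + + 0 + s)) (sumFin-cong {k} (λ j → reassoc c (+ toℕ j))) ⟩
  + 2 * (c + + 0 + sumFin {k} (λ j → (c + + 1) + + toℕ j))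
    ≡⟨ ℤP.*-distribˡ-+ (+ 2) (c + + 0) _ ⟩
  + 2 * (c + + 0) + + 2 * sumFin {k} (λ j → (c + + 1) + + toℕ j)
    ≡⟨ cong (λ s → + 2 * (c + + 0) + s) (sumFin-arithmetic k (c + + 1)) ⟩
  + 2 * (c + + 0) + + k * (+ 2 * (c + + 1) + + k - + 1)
    ≡⟨ collect c (+ k) ⟩
  + suc k * (+ 2 * c + + suc k - + 1)
    ∎
  where
  open ≡-Reasoning
  reassoc : ∀ c t → c + (+ 1 + t) ≡ (c + + 1) + t
  reassoc = solve-∀
  collect : ∀ c k → + 2 * (c + + 0) + k * (+ 2 * (c + + 1) + k - + 1) ≡ (+ 1 + k) * (+ 2 * c + (+ 1 + k) - + 1)
  collect = solve-∀

sumFin-suc-toℕ : ∀ l → + 2 * sumFin {l} (λ j → + suc (toℕ j)) ≡ + l * + suc l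
sumFin-suc-toℕ l = trans (sumFin-arithmetic l (+ 1)) (cong (λ s → + l * s) (simplify (+ l)))
  where
  simplify : ∀ l → + 2 * + 1 + l - + 1 ≡ + 1 + l
  simplify = solve-∀

sumFin-shift⇔ : ∀ {l} (g : Fin l → ℤ) (k : ℤ) →
                + l * k ≡ sumFin {l} (λ j → g j - + suc (toℕ j))
                ⇔ sumFin (λ j → g j - k) ≡ sumFin {l} (λ j → + suc (toℕ j))
sumFin-shift⇔ {l} g k = mk⇔
  (λ lk≡ → trans shifted (difference-swap Σg Σj+1 (+ l * k) (trans lk≡ labelled)))
  (λ Σ≡ → trans (difference-swap⁻¹ Σg Σj+1 (+ l * k) (trans (sym shifted) Σ≡)) (sym labelled))
  where
  Σg Σj+1 : ℤ
  Σg    = sumFin g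
  Σj+1  = sumFin {l} (λ j → + suc (toℕ j))
  shifted : sumFin (λ j → g j - k) ≡ Σg - + l * k
  shifted = trans (sumFin-- g (λ _ → k)) (cong (λ s → Σg - s) (sumFin-const {l} k))
  labelled : sumFin {l} (λ j → g j - + suc (toℕ j)) ≡ Σg - Σj+1
  labelled = sumFin-- {l} g (λ j → + suc (toℕ j))
  difference-swap : ∀ g s x → x ≡ g - s → g - x ≡ s
  difference-swap g s x refl = solve g s
    where
    solve : ∀ g s → g - (g - s) ≡ s
    solve = solve-∀
  difference-swap⁻¹ : ∀ g s x → g - x ≡ s → x ≡ g - s
  difference-swap⁻¹ g s x refl = solve g x
    where
    solve : ∀ g x → x ≡ g - (g - x)
    solve = solve-∀

minimum : ∀ (xs : List ℤ) → 0 ℕ.< length xs → Σ ℤ λ μ → μ ∈ xs × (∀ {y} → y ∈ xs → μ ≤ y)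
minimum (x ∷ xs) _ = min x xs , min∈ , min≤
  where
  min∈ : min x xs ∈ x ∷ xs
  min∈ with argmin-sel (λ y → y) x xs
  ... | inj₁ min≡x  = here min≡x
  ... | inj₂ min∈xs = there min∈xs
  min≤ : ∀ {y} → y ∈ x ∷ xs → min x xs ≤ y
  min≤ (here refl) = min≤⊤ x xs
  min≤ (there y∈)  = All.lookup (min≤xs x xs) y∈

Unique-resp-↭ : ∀ {A : Set} {xs ys : List A} → xs ↭ ys → Unique xs → Unique ys
Unique-resp-↭ ↭.refl               u                       = u
Unique-resp-↭ (↭.prep x p)        (x∉ ∷ u)                = All-resp-↭ p x∉ ∷ Unique-resp-↭ p u
Unique-resp-↭ (↭.swap x y p)      ((x≢y ∷ x∉) ∷ (y∉ ∷ u)) =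
  ((x≢y ∘ sym) ∷ All-resp-↭ p y∉) ∷ (All-resp-↭ p x∉ ∷ Unique-resp-↭ p u)
Unique-resp-↭ (↭.trans p q)       u                       = Unique-resp-↭ q (Unique-resp-↭ p u)

sumℤ-↭ : ∀ {xs ys} → xs ↭ ys → sumℤ xs ≡ sumℤ ys
sumℤ-↭ ↭.refl        = refl
sumℤ-↭ (↭.prep x p)   = cong (λ s → x + s) (sumℤ-↭ p)
sumℤ-↭ (↭.swap x y p) = trans (cong (λ s → x + (y + s)) (sumℤ-↭ p)) (left-comm x y _)
  where
  left-comm : ∀ a b c → a + (b + c) ≡ b + (a + c)
  left-comm = solve-∀
sumℤ-↭ (↭.trans p q)  = trans (sumℤ-↭ p) (sumℤ-↭ q)

same-members⇒↭ : ∀ {A : Set} (xs ys : List A) → Unique xs → Unique ys →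
                 (∀ {x} → x ∈ xs → x ∈ ys) → (∀ {x} → x ∈ ys → x ∈ xs) → xs ↭ ys
same-members⇒↭ []       []       _          _  _     _     = ↭.refl
same-members⇒↭ []       (y ∷ ys) _          _  _     ys⊆xs with ys⊆xs (here refl)
... | ()
same-members⇒↭ (x ∷ xs) ys       (x∉xs ∷ u) uy xs⊆ys ys⊆xs with ∈-∃++ (xs⊆ys (here refl))
... | us , vs , refl =
  ↭.trans (↭.prep x (same-members⇒↭ xs (us ++ vs) u (AllPairs.tail u′) to from)) (↭-sym (shift x us vs))
  where
  u′ : Unique (x ∷ us ++ vs)
  u′ = Unique-resp-↭ (shift x us vs) uy
  ∉-All : ∀ {A : Set} {z : A} {zs} → All (z ≢_) zs → z ∉ zs
  ∉-All (z≢ ∷ _)  (here e)  = z≢ e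
  ∉-All (_ ∷ ps)  (there i) = ∉-All ps i
  to : ∀ {y} → y ∈ xs → y ∈ us ++ vs
  to y∈xs with ∈-resp-↭ (shift x us vs) (xs⊆ys (there y∈xs))
  ... | here refl = ⊥-elim (∉-All x∉xs y∈xs)
  ... | there i   = i
  from : ∀ {y} → y ∈ us ++ vs → y ∈ xs
  from y∈ with ys⊆xs (∈-resp-↭ (↭-sym (shift x us vs)) (there y∈))
  ... | here refl = ⊥-elim (∉-All (AllPairs.head u′) y∈)
  ... | there i   = i

-- Lattice paths

eastBefore-mono : ∀ p j → eastBefore p j ℕ.≤ eastBefore p (suc j)
eastBefore-mono []      j       = z≤n
eastBefore-mono (S ∷ p) zero    = z≤n
eastBefore-mono (S ∷ p) (suc j) = eastBefore-mono p j
eastBefore-mono (E ∷ p) j       = s≤s (eastBefore-mono p j)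

private
  prefix-before-south : ∀ p j → j ℕ.< countS p →
                        Σ ℕ λ k → countS (take k p) ≡ j × countE (take k p) ≡ eastBefore p j
  prefix-before-south (S ∷ p) zero    _         = 0 , refl , refl
  prefix-before-south (S ∷ p) (suc j) (s≤s j<c) with prefix-before-south p j j<c
  ... | k , s≡j , e≡a = suc k , cong suc s≡j , e≡a
  prefix-before-south (E ∷ p) j       j<c       with prefix-before-south p j j<c
  ... | k , s≡j , e≡a = suc k , s≡j , cong suc e≡a

  line-split : ∀ m n j → j ℕ.≤ m → m ℕ.* n ≡ n ℕ.* j ℕ.+ n ℕ.* (m ℕ.∸ j)
  line-split m n j j≤m = trans (ℕP.*-comm m n)
    (trans (cong (n ℕ.*_) (sym (ℕP.m+[n∸m]≡n j≤m))) (ℕP.*-distribˡ-+ n j (m ℕ.∸ j)))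

eastBefore-below-line : ∀ {m n p} → IsDyck m n p → ∀ j → j ℕ.< m → m ℕ.* eastBefore p j ℕ.≤ n ℕ.* j
eastBefore-below-line {m} {n} {p} (#S , _ , below) j j<m with prefix-before-south p j (subst (j ℕ.<_) (sym #S) j<m)
... | k , s≡j , e≡a = ℕP.+-cancelʳ-≤ (n ℕ.* (m ℕ.∸ j)) _ _
      (subst₂ (λ a b → m ℕ.* a ℕ.+ n ℕ.* (m ℕ.∸ j) ℕ.≤ b) e≡a (line-split m n j (ℕP.<⇒≤ j<m))
        (subst (λ s → m ℕ.* countE (take k p) ℕ.+ n ℕ.* (m ℕ.∸ s) ℕ.≤ m ℕ.* n) s≡j (below k)))

private
  countE-take : ∀ k p → countE (take k p) ℕ.≤ countE p
  countE-take zero    p       = z≤n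
  countE-take (suc k) []      = z≤n
  countE-take (suc k) (S ∷ p) = countE-take k p
  countE-take (suc k) (E ∷ p) = s≤s (countE-take k p)

  countE-take-≤-eastBefore : ∀ k p → countS (take k p) ℕ.< countS p →
                             countE (take k p) ℕ.≤ eastBefore p (countS (take k p))
  countE-take-≤-eastBefore zero    p       _       = z≤n
  countE-take-≤-eastBefore (suc k) (S ∷ p) (s≤s s<c) = countE-take-≤-eastBefore k p s<c
  countE-take-≤-eastBefore (suc k) (E ∷ p) s<c     = s≤s (countE-take-≤-eastBefore k p s<c)

IsDyck-intro : ∀ m n p → countS p ≡ m → countE p ≡ n →
               (∀ j → j ℕ.< m → m ℕ.* eastBefore p j ℕ.≤ n ℕ.* j) → IsDyck m n p
IsDyck-intro m n p #S #E below = #S , #E , below-at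
  where
  below-at : ∀ k → m ℕ.* countE (take k p) ℕ.+ n ℕ.* (m ℕ.∸ countS (take k p)) ℕ.≤ m ℕ.* n
  below-at k with countS (take k p) ℕ.<? m
  ... | yes s<m = begin
    m ℕ.* e ℕ.+ n ℕ.* (m ℕ.∸ s)                  ≤⟨ ℕP.+-monoˡ-≤ _ (ℕP.*-monoʳ-≤ m
                                                     (countE-take-≤-eastBefore k p (subst (s ℕ.<_) (sym #S) s<m))) ⟩
    m ℕ.* eastBefore p s ℕ.+ n ℕ.* (m ℕ.∸ s)     ≤⟨ ℕP.+-monoˡ-≤ _ (below s s<m) ⟩
    n ℕ.* s ℕ.+ n ℕ.* (m ℕ.∸ s)                  ≡⟨ line-split m n s (ℕP.<⇒≤ s<m) ⟨
    m ℕ.* n                                      ∎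
    where
    open ℕP.≤-Reasoning
    s e : ℕ
    s = countS (take k p)
    e = countE (take k p)
  ... | no s≮m = begin
    m ℕ.* e ℕ.+ n ℕ.* (m ℕ.∸ s)   ≡⟨ cong (λ d → m ℕ.* e ℕ.+ n ℕ.* d) (ℕP.m≤n⇒m∸n≡0 (ℕP.≮⇒≥ s≮m)) ⟩
    m ℕ.* e ℕ.+ n ℕ.* 0           ≡⟨ trans (cong (m ℕ.* e ℕ.+_) (ℕP.*-zeroʳ n)) (ℕP.+-identityʳ _) ⟩
    m ℕ.* e                       ≤⟨ ℕP.*-monoʳ-≤ m (subst (e ℕ.≤_) #E (countE-take k p)) ⟩
    m ℕ.* n                       ∎
    where
    open ℕP.≤-Reasoning
    s e : ℕ
    s = countS (take k p)
    e = countE (take k p)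

eastBefore-injective : ∀ p q → countS p ≡ countS q → countE p ≡ countE q →
                       (∀ j → j ℕ.< countS p → eastBefore p j ≡ eastBefore q j) → p ≡ q
eastBefore-injective []      []      _  _  _ = refl
eastBefore-injective []      (S ∷ q) () _  _
eastBefore-injective []      (E ∷ q) _  () _
eastBefore-injective (S ∷ p) []      () _  _
eastBefore-injective (E ∷ p) []      _  () _
eastBefore-injective (S ∷ p) (S ∷ q) #S #E same =
  cong (S ∷_) (eastBefore-injective p q (ℕP.suc-injective #S) #E (λ j j<c → same (suc j) (s≤s j<c)))
eastBefore-injective (E ∷ p) (E ∷ q) #S #E same =
  cong (E ∷_) (eastBefore-injective p q #S (ℕP.suc-injective #E) (λ j j<c → ℕP.suc-injective (same j j<c)))
eastBefore-injective (S ∷ p) (E ∷ q) _  _  same with same 0 (s≤s z≤n)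
... | ()
eastBefore-injective (E ∷ p) (S ∷ q) #S _  same with same 0 (subst (0 ℕ.<_) (sym #S) (s≤s z≤n))
... | ()

eastSteps : ℕ → List Step → List Step
eastSteps zero    w = w
eastSteps (suc t) w = E ∷ eastSteps t w

countS-eastSteps : ∀ t w → countS (eastSteps t w) ≡ countS w
countS-eastSteps zero    w = refl
countS-eastSteps (suc t) w = countS-eastSteps t w

countE-eastSteps : ∀ t w → countE (eastSteps t w) ≡ t ℕ.+ countE w
countE-eastSteps zero    w = refl
countE-eastSteps (suc t) w = cong suc (countE-eastSteps t w)

eastBefore-eastSteps : ∀ t w j → eastBefore (eastSteps t w) j ≡ t ℕ.+ eastBefore w j
eastBefore-eastSteps zero    w j = refl
eastBefore-eastSteps (suc t) w j = cong suc (eastBefore-eastSteps t w j)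

staircase : (x c : ℕ) → (ℕ → ℕ) → ℕ → List Step
staircase x zero    A n = eastSteps (n ℕ.∸ x) []
staircase x (suc c) A n = eastSteps (A 0 ℕ.∸ x) (S ∷ staircase (A 0) c (A ∘ suc) n)

private
  ∸-shuffle : ∀ {x a} e → x ℕ.≤ a → a ℕ.∸ x ℕ.+ e ℕ.+ x ≡ e ℕ.+ a
  ∸-shuffle {x} {a} e x≤a = begin
    a ℕ.∸ x ℕ.+ e ℕ.+ x     ≡⟨ ℕP.+-assoc (a ℕ.∸ x) e x ⟩
    a ℕ.∸ x ℕ.+ (e ℕ.+ x)   ≡⟨ cong (a ℕ.∸ x ℕ.+_) (ℕP.+-comm e x) ⟩
    a ℕ.∸ x ℕ.+ (x ℕ.+ e)   ≡⟨ ℕP.+-assoc (a ℕ.∸ x) x e ⟨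
    a ℕ.∸ x ℕ.+ x ℕ.+ e     ≡⟨ cong (ℕ._+ e) (ℕP.m∸n+n≡m x≤a) ⟩
    a ℕ.+ e                 ≡⟨ ℕP.+-comm a e ⟩
    e ℕ.+ a                 ∎
    where open ≡-Reasoning

countS-staircase : ∀ x c A n → countS (staircase x c A n) ≡ c
countS-staircase x zero    A n = countS-eastSteps (n ℕ.∸ x) []
countS-staircase x (suc c) A n = trans (countS-eastSteps (A 0 ℕ.∸ x) _) (cong suc (countS-staircase (A 0) c (A ∘ suc) n))

countE-staircase : ∀ x c A n → (∀ j → A j ℕ.≤ A (suc j)) → x ℕ.≤ A 0 → A c ℕ.≤ n →
                   countE (staircase x c A n) ℕ.+ x ≡ n
countE-staircase x zero    A n _      x≤A₀ A₀≤n =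
  trans (cong (ℕ._+ x) (trans (countE-eastSteps (n ℕ.∸ x) []) (ℕP.+-identityʳ (n ℕ.∸ x))))
        (ℕP.m∸n+n≡m (ℕP.≤-trans x≤A₀ A₀≤n))
countE-staircase x (suc c) A n A-mono x≤A₀ Ac≤n = begin
  countE (eastSteps (A 0 ℕ.∸ x) (S ∷ rest)) ℕ.+ x
    ≡⟨ cong (ℕ._+ x) (countE-eastSteps (A 0 ℕ.∸ x) (S ∷ rest)) ⟩
  A 0 ℕ.∸ x ℕ.+ countE rest ℕ.+ x
    ≡⟨ ∸-shuffle (countE rest) x≤A₀ ⟩
  countE rest ℕ.+ A 0
    ≡⟨ countE-staircase (A 0) c (A ∘ suc) n (A-mono ∘ suc) (A-mono 0) Ac≤n ⟩
  n
    ∎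
  where
  open ≡-Reasoning
  rest : List Step
  rest = staircase (A 0) c (A ∘ suc) n

eastBefore-staircase : ∀ x c A n → (∀ j → A j ℕ.≤ A (suc j)) → x ℕ.≤ A 0 →
                       ∀ j → j ℕ.< c → eastBefore (staircase x c A n) j ℕ.+ x ≡ A j
eastBefore-staircase x (suc c) A n A-mono x≤A₀ zero    _ = begin
  eastBefore (eastSteps (A 0 ℕ.∸ x) (S ∷ _)) 0 ℕ.+ x ≡⟨ cong (ℕ._+ x) (eastBefore-eastSteps (A 0 ℕ.∸ x) (S ∷ _) 0) ⟩
  A 0 ℕ.∸ x ℕ.+ 0 ℕ.+ x                             ≡⟨ ∸-shuffle 0 x≤A₀ ⟩
  A 0                                               ∎
  where open ≡-Reasoning
eastBefore-staircase x (suc c) A n A-mono x≤A₀ (suc j) (s≤s j<c) = begin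
  eastBefore (eastSteps (A 0 ℕ.∸ x) (S ∷ rest)) (suc j) ℕ.+ x
    ≡⟨ cong (ℕ._+ x) (eastBefore-eastSteps (A 0 ℕ.∸ x) (S ∷ rest) (suc j)) ⟩
  A 0 ℕ.∸ x ℕ.+ eastBefore rest j ℕ.+ x
    ≡⟨ ∸-shuffle (eastBefore rest j) x≤A₀ ⟩
  eastBefore rest j ℕ.+ A 0
    ≡⟨ eastBefore-staircase (A 0) c (A ∘ suc) n (A-mono ∘ suc) (A-mono 0) j j<c ⟩
  A (suc j)
    ∎
  where
  open ≡-Reasoning
  rest : List Step
  rest = staircase (A 0) c (A ∘ suc) n

label-<-≤ : ∀ {r U V A B} q → U ℕ.≤ r → A ℕ.< B → + U + (q + + A) * + r ≤ + V + (q + + B) * + r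
label-<-≤ {r} {U} {V} {A} {B} q U≤r A<B = begin
  + U + (q + + A) * + r         ≤⟨ ℤP.+-monoˡ-≤ ((q + + A) * + r) (+≤+ U≤r) ⟩
  + r + (q + + A) * + r         ≡⟨ absorb (+ r) q (+ A) ⟩
  (q + (+ 1 + + A)) * + r       ≤⟨ ℤP.*-monoʳ-≤-nonNeg (+ r) (ℤP.+-monoʳ-≤ q (+≤+ A<B)) ⟩
  (q + + B) * + r               ≤⟨ ℤP.i≤j+i _ (+ V) ⟩
  + V + (q + + B) * + r         ∎
  where
  open ℤP.≤-Reasoning
  absorb : ∀ r q a → r + (q + a) * r ≡ (q + (+ 1 + a)) * r
  absorb = solve-∀

label-≤ : ∀ {r U V A B} q → U ℕ.≤ r → A ℕ.≤ B → (A ≡ B → U ℕ.≤ V) →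
          + U + (q + + A) * + r ≤ + V + (q + + B) * + r
label-≤ {A = A} {B} q U≤r A≤B A≡B⇒U≤V with A ℕ.≟ B
... | yes refl = ℤP.+-monoˡ-≤ ((q + + A) * + _) (+≤+ (A≡B⇒U≤V refl))
... | no A≢B   = label-<-≤ q U≤r (ℕP.≤∧≢⇒< A≤B A≢B)

-- f-spec is the defining property f(x) = f̃(x + k) of 𝒜, rewritten via γ(v_j) = n j − a_j m.
module LabelledFunction (m′ n : ℕ) (cop : Coprime (suc m′) n) (r : ℕ)
    (a Υ : Fin (suc m′) → ℕ) (Υ-range : ∀ j → 1 ℕ.≤ Υ j × Υ j ℕ.≤ r) (k : ℤ) (f : ℤ → ℤ)
    (f-spec : ∀ j q → f (+ n * + toℕ j + q * + suc m′ - k) ≡ + Υ j + (q + + a j) * + r) where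

  open Residues m′ n cop

  window : Fin m → ℤ
  window j = + n * + toℕ j + (- + a j) * + m - k

  f-window : ∀ j → f (window j) ≡ + Υ j
  f-window j = trans (f-spec j (- + a j)) (cancel (+ Υ j) (+ a j) (+ r))
    where
    cancel : ∀ u a r → u + (- a + a) * r ≡ u
    cancel = solve-∀

  f-decompose : ∀ x → Σ (Fin m) λ j → Σ ℤ λ q → x ≡ + n * + toℕ j + q * + m - k × f x ≡ + Υ j + (q + + a j) * + r
  f-decompose x =
    let (j , q , x+k≡) = decompose (x + k)
        x≡ = trans (sym (+--cancel x k)) (cong (_- k) x+k≡)
    in j , q , x≡ , trans (cong f x≡) (f-spec j q)

  f-periodic : ∀ x → f (x + + m) ≡ f x + + r
  f-periodic x =
    let (j , q , x≡ , fx≡) = f-decompose x in begin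
    f (x + + m)                                    ≡⟨ cong (λ y → f (y + + m)) x≡ ⟩
    f (+ n * + toℕ j + q * + m - k + + m)          ≡⟨ cong f (step (+ n * + toℕ j) q (+ m) k) ⟩
    f (+ n * + toℕ j + (q + + 1) * + m - k)        ≡⟨ f-spec j (q + + 1) ⟩
    + Υ j + (q + + 1 + + a j) * + r                ≡⟨ step′ (+ Υ j) q (+ a j) (+ r) ⟩
    + Υ j + (q + + a j) * + r + + r                ≡⟨ cong (_+ + r) fx≡ ⟨
    f x + + r                                      ∎
    where
    open ≡-Reasoning
    step : ∀ x q m k → x + q * m - k + m ≡ x + (q + + 1) * m - k
    step = solve-∀
    step′ : ∀ u q a r → u + (q + + 1 + a) * r ≡ u + (q + a) * r + r
    step′ = solve-∀

  window-complete : ∀ x → + 1 ≤ f x → f x ≤ + r → Σ (Fin m) λ j → x ≡ window j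
  window-complete x 1≤fx fx≤r =
    let (j , q , x≡ , fx≡) = f-decompose x
        q+a≡0 = window-offset-zero (q + + a j) 1≤fx fx≤r (+≤+ (proj₁ (Υ-range j))) (+≤+ (proj₂ (Υ-range j))) fx≡
    in j , trans x≡ (cong (λ p → + n * + toℕ j + p * + m - k) (solve-for-q q (+ a j) q+a≡0))
    where
    solve-for-q : ∀ q a → q + a ≡ + 0 → q ≡ - a
    solve-for-q q a e = trans (isolate q a) (trans (cong (_- a) e) (ℤP.+-identityˡ (- a)))
      where
      isolate : ∀ q a → q ≡ (q + a) - a
      isolate = solve-∀

  window-injective : ∀ {i j} → window i ≡ window j → i ≡ j
  window-injective {i} {j} e = proj₁ (decompose-unique (- + a i) (- + a j)
    (trans (sym (-+-cancel _ k)) (trans (cong (_+ k) e) (-+-cancel _ k))))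

  window-distinct : ∀ {i j} → i ≢ j → DistinctMod m (window i) (window j)
  window-distinct {i} {j} i≢j m∣wi-wj =
    let divides c wi-wj≡cm = ∣ᵤ⇒∣ {+ m} {window i - window j} m∣wi-wj
    in i≢j (proj₁ (decompose-unique (- + a i) (- + a j + c) (begin
      + n * + toℕ i + (- + a i) * + m                   ≡⟨ -+-cancel _ k ⟨
      window i + k                                      ≡⟨ cong (_+ k) (add-difference (window i) (window j)) ⟩
      window j + (window i - window j) + k              ≡⟨ cong (λ d → window j + d + k) wi-wj≡cm ⟩
      window j + c * + m + k                            ≡⟨ collect (+ n * + toℕ j) (+ a j) (+ m) k c ⟩
      + n * + toℕ j + (- + a j + c) * + m               ∎)))
    where
    open ≡-Reasoning
    add-difference : ∀ x y → x ≡ y + (x - y)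
    add-difference = solve-∀
    collect : ∀ x a m k c → x + (- a) * m - k + c * m + k ≡ x + (- a + c) * m
    collect = solve-∀

  windows : List ℤ
  windows = map window (allFin m)

  length-windows : length windows ≡ m
  length-windows = trans (LP.length-map window (allFin m)) (LP.length-tabulate (λ j → j))

  windows-distinct : AllPairs (DistinctMod m) windows
  windows-distinct = AllPairsP.map⁺ (AllPairs.map window-distinct (allFin⁺ m))

  ∈-windows⇔ : ∀ x → (+ 1 ≤ f x × f x ≤ + r) ⇔ x ∈ windows
  ∈-windows⇔ x = mk⇔ to from
    where
    to : + 1 ≤ f x × f x ≤ + r → x ∈ windows
    to (1≤fx , fx≤r) = let (j , x≡) = window-complete x 1≤fx fx≤r
                       in subst (_∈ windows) (sym x≡) (∈-map⁺ window (∈-allFin j))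
    from : x ∈ windows → + 1 ≤ f x × f x ≤ + r
    from x∈ = let (j , _ , x≡) = ∈-map⁻ window x∈
              in subst (λ v → + 1 ≤ v × v ≤ + r) (sym (trans (cong f x≡) (f-window j)))
                       (+≤+ (proj₁ (Υ-range j)) , +≤+ (proj₂ (Υ-range j)))

  isAffineComp : + 2 * sumℤ windows ≡ + m * + suc m → IsAffineComp m r f
  isAffineComp sum≡ = f-periodic , windows , length-windows , windows-distinct , ∈-windows⇔ , sum≡

  module _ (a-mono : ∀ i j → toℕ j ≡ suc (toℕ i) → a i ℕ.≤ a j)
           (Υ-mono : ∀ i j → toℕ j ≡ suc (toℕ i) → a i ≡ a j → Υ i ℕ.≤ Υ j)
           (a-wrap : ∀ j → suc (toℕ j) ≡ m → a j ℕ.< n ℕ.+ a F.zero) where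

    private
      f-step : ∀ j q → Dec (suc (toℕ j) ℕ.< m) →
               f (+ n * + toℕ j + q * + m - k) ≤ f (+ n * + toℕ j + q * + m - k + + n)
      f-step j q (yes j+1<m) = begin
        f (+ n * + toℕ j + q * + m - k)          ≡⟨ f-spec j q ⟩
        + Υ j + (q + + a j) * + r                ≤⟨ label-≤ q (proj₂ (Υ-range j)) (a-mono j j′ toℕ-j′) (Υ-mono j j′ toℕ-j′) ⟩
        + Υ j′ + (q + + a j′) * + r              ≡⟨ f-spec j′ q ⟨
        f (+ n * + toℕ j′ + q * + m - k)         ≡⟨ cong (λ i → f (+ n * + i + q * + m - k)) toℕ-j′ ⟩
        f (+ n * (+ 1 + + toℕ j) + q * + m - k)  ≡⟨ cong f (add-n (+ n) (+ toℕ j) q (+ m) k) ⟨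
        f (+ n * + toℕ j + q * + m - k + + n)    ∎
        where
        open ℤP.≤-Reasoning
        j′ : Fin m
        j′ = fromℕ< j+1<m
        toℕ-j′ : toℕ j′ ≡ suc (toℕ j)
        toℕ-j′ = FP.toℕ-fromℕ< j+1<m
        add-n : ∀ n j q m k → n * j + q * m - k + n ≡ n * (+ 1 + j) + q * m - k
        add-n = solve-∀
      f-step j q (no j+1≮m) = begin
        f (+ n * + toℕ j + q * + m - k)              ≡⟨ f-spec j q ⟩
        + Υ j + (q + + a j) * + r                    ≤⟨ label-<-≤ q (proj₂ (Υ-range j)) (a-wrap j last) ⟩
        + Υ F.zero + (q + + (n ℕ.+ a F.zero)) * + r  ≡⟨ cong (λ p → + Υ F.zero + p * + r) (reassoc q (+ n) (+ a F.zero)) ⟩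
        + Υ F.zero + (q + + n + + a F.zero) * + r    ≡⟨ f-spec F.zero (q + + n) ⟨
        f (+ n * + 0 + (q + + n) * + m - k)          ≡⟨ cong f (wrap-around (+ n) (+ toℕ j) q (+ m) k
                                                          (cong +_ (sym last))) ⟨
        f (+ n * + toℕ j + q * + m - k + + n)        ∎
        where
        open ℤP.≤-Reasoning
        last : suc (toℕ j) ≡ m
        last = ℕP.≤-antisym (FP.toℕ<n j) (ℕP.≮⇒≥ j+1≮m)
        reassoc : ∀ q n a → q + (n + a) ≡ q + n + a
        reassoc q n a = sym (ℤP.+-assoc q n a)
        wrap-around : ∀ n j q m k → m ≡ + 1 + j → n * j + q * m - k + n ≡ n * + 0 + (q + n) * m - k
        wrap-around n j q m k refl = solve n j q k
          where
          solve : ∀ n j q k → n * j + q * (+ 1 + j) - k + n ≡ n * + 0 + (q + n) * (+ 1 + j) - k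
          solve = solve-∀

    nStable : NStable n f
    nStable x =
      let (j , q , x≡ , _) = f-decompose x
      in subst (λ y → f y ≤ f (y + + n)) (sym x≡) (f-step j q (suc (toℕ j) ℕ.<? m))

  hasWeight : (w : Fin r → ℕ) → (∀ i → length (filter (λ j → Υ j ℕ.≟ suc (toℕ i)) (allFin m)) ≡ w i) →
              HasWeight f w
  hasWeight w #Υ⁻¹≡w i = map window level , trans (LP.length-map window level) (#Υ⁻¹≡w i) , distinct , ∈⇔
    where
    level : List (Fin m)
    level = filter (λ j → Υ j ℕ.≟ suc (toℕ i)) (allFin m)
    distinct : AllPairs _≢_ (map window level)
    distinct = AllPairsP.map⁺ (AllPairsP.filter⁺ (λ j → Υ j ℕ.≟ suc (toℕ i))
                 (AllPairs.map (λ i≢j → i≢j ∘ window-injective) (allFin⁺ m)))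
    ∈⇔ : ∀ x → (f x ≡ + suc (toℕ i)) ⇔ x ∈ map window level
    ∈⇔ x = mk⇔ to from
      where
      to : f x ≡ + suc (toℕ i) → x ∈ map window level
      to fx≡ =
        let (j , x≡) = window-complete x (subst (+ 1 ≤_) (sym fx≡) (+≤+ (s≤s z≤n)))
                                         (subst (_≤ + r) (sym fx≡) (+≤+ (FP.toℕ<n i)))
            Υj≡ = ℤP.+-injective (trans (sym (f-window j)) (trans (cong f (sym x≡)) fx≡))
        in subst (_∈ map window level) (sym x≡)
             (∈-map⁺ window (∈-filter⁺ (λ j → Υ j ℕ.≟ suc (toℕ i)) (∈-allFin j) Υj≡))
      from : x ∈ map window level → f x ≡ + suc (toℕ i)
      from x∈ =
        let (j , j∈ , x≡) = ∈-map⁻ window x∈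
        in trans (cong f x≡) (trans (f-window j) (cong +_ (proj₂ (∈-filter⁻ (λ j → Υ j ℕ.≟ suc (toℕ i)) j∈))))

-- The map 𝒜

even-or-odd : ∀ m → Σ ℕ λ h → m ≡ h ℕ.+ h ⊎ m ≡ suc (h ℕ.+ h)
even-or-odd zero    = 0 , inj₁ refl
even-or-odd (suc m) with even-or-odd m
... | h , inj₁ m≡2h   = h , inj₂ (cong suc m≡2h)
... | h , inj₂ m≡2h+1 = suc h , inj₁ (cong suc (trans m≡2h+1 (sym (ℕP.+-suc h h))))

coprime⇒[n-1][m-1]-even : ∀ m n → Coprime m n → Σ ℤ λ H → + 2 * H ≡ (+ n - + 1) * (+ m - + 1)
coprime⇒[n-1][m-1]-even m n cop with even-or-odd m | even-or-odd n
... | h , inj₂ refl | _ = (+ n - + 1) * + h , halve-right (+ n) (+ h)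
  where
  halve-right : ∀ n h → + 2 * ((n - + 1) * h) ≡ (n - + 1) * (+ 1 + (h + h) - + 1)
  halve-right = solve-∀
... | _ | h , inj₂ refl = + h * (+ m - + 1) , halve-left (+ m) (+ h)
  where
  halve-left : ∀ m h → + 2 * (h * (m - + 1)) ≡ (+ 1 + (h + h) - + 1) * (m - + 1)
  halve-left = solve-∀
... | h , inj₁ refl | h′ , inj₁ refl = ⊥-elim (2≢1 (cop (ℕD.divides h (double h) , ℕD.divides h′ (double h′))))
  where
  double : ∀ x → x ℕ.+ x ≡ x ℕ.* 2
  double x = trans (cong (x ℕ.+_) (sym (ℕP.+-identityʳ x))) (ℕP.*-comm 2 x)
  2≢1 : 2 ≢ 1
  2≢1 ()

module _ {m′ n r : ℕ} (P : SSPF (suc m′) n r) where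

  private
    m : ℕ
    m = suc m′

  γv≡window-form : ∀ j → γv P j ≡ + n * + toℕ j + (- + aCoord P j) * + m
  γv≡window-form j = rearrange (+ m) (+ n) (+ aCoord P j) (+ toℕ j)
    where
    rearrange : ∀ m n a j → m * n - m * a - n * (m - j) ≡ n * j + (- a) * m
    rearrange = solve-∀

  IsA-spec⇒f-spec : ∀ (g : ℤ → ℤ) k → (∀ j p → g (γv P j + p * + m - k) ≡ + Υ P j + p * + r) →
                    ∀ j q → g (+ n * + toℕ j + q * + m - k) ≡ + Υ P j + (q + + aCoord P j) * + r
  IsA-spec⇒f-spec g k g-spec j q = begin
    g (+ n * + toℕ j + q * + m - k)
      ≡⟨ cong g (regroup (+ n * + toℕ j) (+ aCoord P j) q (+ m) k) ⟩
    g (+ n * + toℕ j + (- + aCoord P j) * + m + (q + + aCoord P j) * + m - k)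
      ≡⟨ cong (λ γ → g (γ + (q + + aCoord P j) * + m - k)) (γv≡window-form j) ⟨
    g (γv P j + (q + + aCoord P j) * + m - k)
      ≡⟨ g-spec j (q + + aCoord P j) ⟩
    + Υ P j + (q + + aCoord P j) * + r
      ∎
    where
    open ≡-Reasoning
    regroup : ∀ x a q m k → x + q * m - k ≡ x + (- a) * m + (q + a) * m - k
    regroup = solve-∀

  f-spec⇒IsA-spec : ∀ (g : ℤ → ℤ) k →
                    (∀ j q → g (+ n * + toℕ j + q * + m - k) ≡ + Υ P j + (q + + aCoord P j) * + r) →
                    ∀ j p → g (γv P j + p * + m - k) ≡ + Υ P j + p * + r
  f-spec⇒IsA-spec g k g-spec j p = begin
    g (γv P j + p * + m - k)                                ≡⟨ cong (λ γ → g (γ + p * + m - k)) (γv≡window-form j) ⟩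
    g (+ n * + toℕ j + (- + aCoord P j) * + m + p * + m - k)
      ≡⟨ cong g (regroup (+ n * + toℕ j) (+ aCoord P j) p (+ m) k) ⟩
    g (+ n * + toℕ j + (p - + aCoord P j) * + m - k)        ≡⟨ g-spec j (p - + aCoord P j) ⟩
    + Υ P j + (p - + aCoord P j + + aCoord P j) * + r       ≡⟨ cancel (+ Υ P j) p (+ aCoord P j) (+ r) ⟩
    + Υ P j + p * + r                                       ∎
    where
    open ≡-Reasoning
    regroup : ∀ x a p m k → x + (- a) * m + p * m - k ≡ x + (p - a) * m - k
    regroup = solve-∀
    cancel : ∀ u p a r → u + (p - a + a) * r ≡ u + p * r
    cancel = solve-∀

  aCoord-zero : aCoord P F.zero ≡ 0
  aCoord-zero = ℕP.n≤0⇒n≡0 (ℕP.*-cancelˡ-≤ m (ℕP.≤-trans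
    (eastBefore-below-line (isDyck P) 0 (s≤s z≤n)) (ℕP.≤-reflexive (trans (ℕP.*-zeroʳ n) (sym (ℕP.*-zeroʳ m))))))

  aCoord-< : 1 ℕ.≤ n → ∀ j → aCoord P j ℕ.< n
  aCoord-< 1≤n j = ℕP.*-cancelˡ-< m (aCoord P j) n (begin-strict
    m ℕ.* aCoord P j  ≤⟨ eastBefore-below-line (isDyck P) (toℕ j) (FP.toℕ<n j) ⟩
    n ℕ.* toℕ j       <⟨ ℕP.*-monoʳ-< n {{ℕ.>-nonZero 1≤n}} (FP.toℕ<n j) ⟩
    n ℕ.* m           ≡⟨ ℕP.*-comm n m ⟩
    m ℕ.* n           ∎)
    where open ℕP.≤-Reasoning

  γv-zero : γv P F.zero ≡ + 0
  γv-zero = trans (γv≡window-form F.zero)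
    (trans (cong (λ a → + n * + 0 + (- + a) * + m) aCoord-zero) (vanish (+ n) (+ m)))
    where
    vanish : ∀ n m → n * + 0 + (- + 0) * m ≡ + 0
    vanish = solve-∀

  γv-nonneg : ∀ j → + 0 ≤ γv P j
  γv-nonneg j = subst (+ 0 ≤_) (sym (trans (γv≡window-form j) (as-difference (+ n) (+ toℕ j) (+ aCoord P j) (+ m))))
    (ℤP.i≤j⇒0≤j-i (subst₂ _≤_ (ℤP.pos-* m (aCoord P j)) (ℤP.pos-* n (toℕ j))
      (+≤+ (eastBefore-below-line (isDyck P) (toℕ j) (FP.toℕ<n j)))))
    where
    as-difference : ∀ n j a m → n * j + (- a) * m ≡ n * j - m * a
    as-difference = solve-∀

module Forward (m′ n : ℕ) (cop : Coprime (suc m′) n) (1≤n : 1 ℕ.≤ n) {r : ℕ} (P : SSPF (suc m′) n r) where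

  open Residues m′ n cop

  private
    a : Fin m → ℕ
    a = aCoord P

    H : ℤ
    H = proj₁ (coprime⇒[n-1][m-1]-even m n cop)

    Σa : ℤ
    Σa = sumFin (λ j → + a j)

  -- Since Σ_j γ(v_j) = n m (m−1)/2 − m Σ_j a_j, the equation m k = Σ_j (γ(v_j) − (j+1))
  -- forces k = (n−1)(m−1)/2 − 1 − Σ_j a_j; (n−1)(m−1) is even because m, n are coprime.
  k : ℤ
  k = H - + 1 - Σa

  k-spec : + m * k ≡ sumℤ (map (λ j → γv P j - + suc (toℕ j)) (allFin m))
  k-spec = ℤP.*-cancelˡ-≡ (+ 2) _ _ (begin
    + 2 * (+ m * k)                                                       ≡⟨ expand (+ m) H Σa ⟩
    + m * (+ 2 * H) - + 2 * + m - + 2 * + m * Σa                          ≡⟨ cong (λ h → + m * h - + 2 * + m - + 2 * + m * Σa)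
                                                                               (proj₂ (coprime⇒[n-1][m-1]-even m n cop)) ⟩
    + m * ((+ n - + 1) * (+ m - + 1)) - + 2 * + m - + 2 * + m * Σa        ≡⟨ regroup (+ m) (+ n) Σa ⟩
    + n * (+ m * (+ 2 * + 0 + + m - + 1)) - + 2 * + m * Σa
      - + m * (+ 2 * + 1 + + m - + 1)                                     ≡⟨ cong₂ (λ x y → + n * x - + 2 * + m * Σa - y)
                                                                               (sumFin-arithmetic m (+ 0)) (sumFin-arithmetic m (+ 1)) ⟨
    + n * (+ 2 * Σj) - + 2 * + m * Σa - + 2 * Σj+1                        ≡⟨ factor (+ n) (+ m) Σj Σa Σj+1 ⟩
    + 2 * (+ n * Σj - + m * Σa - Σj+1)                                    ≡⟨ cong (+ 2 *_) Σ-labels ⟨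
    + 2 * sumℤ (map (λ j → γv P j - + suc (toℕ j)) (allFin m))            ∎)
    where
    open ≡-Reasoning
    Σj Σj+1 : ℤ
    Σj   = sumFin {m} (λ j → + toℕ j)
    Σj+1 = sumFin {m} (λ j → + suc (toℕ j))
    expand : ∀ m h s → + 2 * (m * (h - + 1 - s)) ≡ m * (+ 2 * h) - + 2 * m - + 2 * m * s
    expand = solve-∀
    regroup : ∀ m n s → m * ((n - + 1) * (m - + 1)) - + 2 * m - + 2 * m * s
                        ≡ n * (m * (+ 2 * + 0 + m - + 1)) - + 2 * m * s - m * (+ 2 * + 1 + m - + 1)
    regroup = solve-∀
    factor : ∀ n m j a j1 → n * (+ 2 * j) - + 2 * m * a - + 2 * j1 ≡ + 2 * (n * j - m * a - j1)
    factor = solve-∀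
    plain-form : ∀ j → γv P j ≡ + n * + toℕ j - + m * + a j
    plain-form j = trans (γv≡window-form P j) (swap-product (+ n * + toℕ j) (+ a j) (+ m))
      where
      swap-product : ∀ x a m → x + (- a) * m ≡ x - m * a
      swap-product = solve-∀
    Σ-labels : sumℤ (map (λ j → γv P j - + suc (toℕ j)) (allFin m)) ≡ + n * Σj - + m * Σa - Σj+1
    Σ-labels = begin
      sumℤ (map (λ j → γv P j - + suc (toℕ j)) (allFin m))        ≡⟨ sumℤ-map-allFin (λ j → γv P j - + suc (toℕ j)) ⟩
      sumFin (λ j → γv P j - + suc (toℕ j))                       ≡⟨ sumFin-- (γv P) (λ j → + suc (toℕ j)) ⟩
      sumFin (γv P) - Σj+1                                        ≡⟨ cong (_- Σj+1) (sumFin-cong plain-form) ⟩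
      sumFin (λ j → + n * + toℕ j - + m * + a j) - Σj+1           ≡⟨ cong (_- Σj+1) (sumFin-- {m} (λ j → + n * + toℕ j) (λ j → + m * + a j)) ⟩
      sumFin {m} (λ j → + n * + toℕ j) - sumFin (λ j → + m * + a j) - Σj+1
                                                                  ≡⟨ cong₂ (λ x y → x - y - Σj+1) (sumFin-*ˡ {m} (+ n) (λ j → + toℕ j))
                                                                                                  (sumFin-*ˡ (+ m) (λ j → + a j)) ⟩
      + n * Σj - + m * Σa - Σj+1                                  ∎

  opaque
    private
      value : ∀ {y} → (Σ (Fin m) λ j → Σ ℤ λ q → y ≡ + n * + toℕ j + q * + m) → ℤ
      value (j , q , _) = + Υ P j + (q + + a j) * + r

      value-unique : ∀ {y} (d : Σ (Fin m) λ j → Σ ℤ λ q → y ≡ + n * + toℕ j + q * + m) j q →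
                     y ≡ + n * + toℕ j + q * + m → value d ≡ + Υ P j + (q + + a j) * + r
      value-unique (j′ , q′ , y≡′) j q y≡ with decompose-unique q′ q (trans (sym y≡′) y≡)
      ... | refl , refl = refl

    f : ℤ → ℤ
    f x = value (decompose (x + k))

    f-spec : ∀ j q → f (+ n * + toℕ j + q * + m - k) ≡ + Υ P j + (q + + a j) * + r
    f-spec j q = value-unique (decompose _) j q (-+-cancel _ k)

  open LabelledFunction m′ n cop r a (Υ P) (Υ-range P) k f f-spec

  γv-k≡window : ∀ j → γv P j - k ≡ window j
  γv-k≡window j = cong (_- k) (γv≡window-form P j)

  isA : IsA P f
  isA = k , k-spec , f-spec⇒IsA-spec P f k f-spec

  isA-unique : ∀ g → IsA P g → ∀ x → f x ≡ g x
  isA-unique g (k′ , k′-spec , g-spec) x =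
    let (j , q , x≡ , fx≡) = f-decompose x
        k′≡k = ℤP.*-cancelˡ-≡ (+ m) k′ k (trans k′-spec (sym k-spec))
    in trans fx≡ (sym (trans (cong g x≡)
         (subst (λ k″ → g (+ n * + toℕ j + q * + m - k″) ≡ + Υ P j + (q + + a j) * + r) k′≡k
                (IsA-spec⇒f-spec P g k′ g-spec j q))))

  affine : IsAffineComp m r f
  affine = isAffineComp (begin
    + 2 * sumℤ windows                        ≡⟨ cong (+ 2 *_) (sumℤ-map-allFin window) ⟩
    + 2 * sumFin window                       ≡⟨ cong (+ 2 *_) (sumFin-cong (λ j → sym (γv-k≡window j))) ⟩
    + 2 * sumFin (λ j → γv P j - k)           ≡⟨ cong (+ 2 *_) (Equivalence.to (sumFin-shift⇔ (γv P) k)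
                                                    (trans k-spec (sumℤ-map-allFin (λ j → γv P j - + suc (toℕ j))))) ⟩
    + 2 * sumFin {m} (λ j → + suc (toℕ j))    ≡⟨ sumFin-suc-toℕ m ⟩
    + m * + suc m                             ∎)
    where open ≡-Reasoning

  stable : NStable n f
  stable = nStable
    (λ i j j≡i+1 → subst (λ t → a i ℕ.≤ eastBefore (path P) t) (sym j≡i+1) (eastBefore-mono (path P) (toℕ i)))
    (Υ-mono P)
    (λ j _ → ℕP.≤-trans (aCoord-< P 1≤n j) (ℕP.m≤m+n n (a F.zero)))

  weight : (w : Fin r → ℕ) → (∀ i → sspfWeight P i ≡ w i) → HasWeight f w
  weight = hasWeight

module Injectivity (m′ n : ℕ) (cop : Coprime (suc m′) n) {r : ℕ} where

  open Residues m′ n cop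

  private
    IsA-spec : SSPF m n r → (ℤ → ℤ) → ℤ → Set
    IsA-spec P f k = ∀ j p → f (γv P j + p * + m - k) ≡ + Υ P j + p * + r

  module Compare (P Q : SSPF m n r) (f g : ℤ → ℤ) (k₁ k₂ : ℤ)
                 (f-spec : IsA-spec P f k₁) (g-spec : IsA-spec Q g k₂) (f≗g : ∀ x → f x ≡ g x) where

    module OfP = LabelledFunction m′ n cop r (aCoord P) (Υ P) (Υ-range P) k₁ f (IsA-spec⇒f-spec P f k₁ f-spec)
    module OfQ = LabelledFunction m′ n cop r (aCoord Q) (Υ Q) (Υ-range Q) k₂ g (IsA-spec⇒f-spec Q g k₂ g-spec)

    window-match : ∀ j → Σ (Fin m) λ j′ → OfP.window j ≡ OfQ.window j′
    window-match j = OfQ.window-complete (OfP.window j)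
      (subst (+ 1 ≤_) g≡Υ (+≤+ (proj₁ (Υ-range P j))))
      (subst (_≤ + r) g≡Υ (+≤+ (proj₂ (Υ-range P j))))
      where
      g≡Υ : + Υ P j ≡ g (OfP.window j)
      g≡Υ = trans (sym (OfP.f-window j)) (f≗g (OfP.window j))

    k₁≤k₂ : k₁ ≤ k₂
    k₁≤k₂ = let (j′ , w₀≡) = window-match F.zero in ℤP.neg-cancel-≤ (begin
      - k₂                  ≡⟨ ℤP.+-identityˡ (- k₂) ⟨
      + 0 - k₂              ≤⟨ ℤP.+-monoˡ-≤ (- k₂) (γv-nonneg Q j′) ⟩
      γv Q j′ - k₂          ≡⟨ cong (_- k₂) (γv≡window-form Q j′) ⟩
      OfQ.window j′          ≡⟨ w₀≡ ⟨
      OfP.window F.zero      ≡⟨ cong (_- k₁) (γv≡window-form P F.zero) ⟨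
      γv P F.zero - k₁      ≡⟨ cong (_- k₁) (γv-zero P) ⟩
      + 0 - k₁              ≡⟨ ℤP.+-identityˡ (- k₁) ⟩
      - k₁                  ∎)
      where open ℤP.≤-Reasoning

  injective : (P Q : SSPF m n r) (f g : ℤ → ℤ) → IsA P f → IsA Q g → (∀ x → f x ≡ g x) → P ≈SSPF Q
  injective P Q f g (k₁ , _ , f-spec) (k₂ , _ , g-spec) f≗g = same-path , λ j → proj₂ (same-column j)
    where
    open Compare P Q f g k₁ k₂ f-spec g-spec f≗g
    k₁≡k₂ : k₁ ≡ k₂
    k₁≡k₂ = ℤP.≤-antisym k₁≤k₂ (Compare.k₁≤k₂ Q P g f k₂ k₁ g-spec f-spec (sym ∘ f≗g))
    same-column : ∀ j → aCoord P j ≡ aCoord Q j × Υ P j ≡ Υ Q j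
    same-column j =
      let (j′ , w≡) = window-match j
          (j≡j′ , -a≡-a′) = decompose-unique (- + aCoord P j) (- + aCoord Q j′)
                              (trans (sym (-+-cancel _ k₁)) (trans (cong₂ _+_ w≡ k₁≡k₂) (-+-cancel _ k₂)))
          Υ≡Υ′ = ℤP.+-injective (trans (sym (OfP.f-window j)) (trans (f≗g _) (trans (cong g w≡) (OfQ.f-window j′))))
      in subst (λ i → aCoord P j ≡ aCoord Q i × Υ P j ≡ Υ Q i) (sym j≡j′)
           (ℤP.+-injective (ℤP.neg-injective -a≡-a′) , Υ≡Υ′)
    #S : countS (path P) ≡ countS (path Q)
    #S = trans (proj₁ (isDyck P)) (sym (proj₁ (isDyck Q)))
    #E : countE (path P) ≡ countE (path Q)
    #E = trans (proj₁ (proj₂ (isDyck P))) (sym (proj₁ (proj₂ (isDyck Q))))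
    same-path : path P ≡ path Q
    same-path = eastBefore-injective (path P) (path Q) #S #E λ t t<#S →
      let t<m = subst (t ℕ.<_) (proj₁ (isDyck P)) t<#S
          toℕ-t = FP.toℕ-fromℕ< t<m
      in subst (λ i → eastBefore (path P) i ≡ eastBefore (path Q) i) toℕ-t (proj₁ (same-column (fromℕ< t<m)))

-- Surjectivity

module _ {m r : ℕ} (f : ℤ → ℤ) (periodic : ∀ x → f (x + + m) ≡ f x + + r) where

  periodic-ℕ : ∀ x (p : ℕ) → f (x + + p * + m) ≡ f x + + p * + r
  periodic-ℕ x zero    = trans (cong f (ℤP.+-identityʳ x)) (sym (ℤP.+-identityʳ (f x)))
  periodic-ℕ x (suc p) = begin
    f (x + + suc p * + m)        ≡⟨ cong f (peel x (+ p) (+ m)) ⟩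
    f (x + + p * + m + + m)      ≡⟨ periodic _ ⟩
    f (x + + p * + m) + + r      ≡⟨ cong (_+ + r) (periodic-ℕ x p) ⟩
    f x + + p * + r + + r        ≡⟨ peel (f x) (+ p) (+ r) ⟨
    f x + + suc p * + r          ∎
    where
    open ≡-Reasoning
    peel : ∀ x p m → x + (+ 1 + p) * m ≡ x + p * m + m
    peel = solve-∀

  periodic-ℤ : ∀ x p → f (x + p * + m) ≡ f x + p * + r
  periodic-ℤ x (+ p)    = periodic-ℕ x p
  periodic-ℤ x -[1+ p ] = begin
    f y                                   ≡⟨ restore (f y) (+ suc p) (+ r) ⟩
    f y + + suc p * + r - + suc p * + r   ≡⟨ cong (_- + suc p * + r) (periodic-ℕ y (suc p)) ⟨
    f (y + + suc p * + m) - + suc p * + r ≡⟨ cong (λ z → f z - + suc p * + r) (restore′ x (+ suc p) (+ m)) ⟩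
    f x - + suc p * + r                   ≡⟨ as-sum (f x) (+ suc p) (+ r) ⟩
    f x + -[1+ p ] * + r                  ∎
    where
    open ≡-Reasoning
    y : ℤ
    y = x + -[1+ p ] * + m
    restore : ∀ v p r → v ≡ v + p * r - p * r
    restore = solve-∀
    restore′ : ∀ x p m → x + (- p) * m + p * m ≡ x
    restore′ = solve-∀
    as-sum : ∀ v p r → v - p * r ≡ v + (- p) * r
    as-sum = solve-∀

DistinctMod⇒≢ : ∀ {m x y} → DistinctMod m x y → x ≢ y
DistinctMod⇒≢ {m} {x} x≢y refl = x≢y (subst (+ m ∣ℤᵤ_) (sym (ℤP.+-inverseʳ x)) (ℕD._∣0 m))

HasWeight-unique : ∀ {r} {f : ℤ → ℤ} {w w′ : Fin r → ℕ} → HasWeight f w → HasWeight f w′ → ∀ i → w i ≡ w′ i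
HasWeight-unique hw hw′ i =
  let (L , #L , L-distinct , ∈L⇔) = hw i
      (L′ , #L′ , L′-distinct , ∈L′⇔) = hw′ i
  in trans (sym #L) (trans (↭-length (same-members⇒↭ L L′ L-distinct L′-distinct
       (λ {x} x∈L → Equivalence.to (∈L′⇔ x) (Equivalence.from (∈L⇔ x) x∈L))
       (λ {x} x∈L′ → Equivalence.to (∈L⇔ x) (Equivalence.from (∈L′⇔ x) x∈L′)))) #L′)

module Surjectivity (m′ n : ℕ) (cop : Coprime (suc m′) n) (r′ : ℕ) (f : ℤ → ℤ)
    (periodic : ∀ x → f (x + + suc m′) ≡ f x + + suc r′)
    (L : List ℤ) (#L : length L ≡ suc m′) (L-distinct : AllPairs (DistinctMod (suc m′)) L)
    (∈L⇔ : ∀ x → (+ 1 ≤ f x × f x ≤ + suc r′) ⇔ x ∈ L) (ΣL : + 2 * sumℤ L ≡ + suc m′ * + suc (suc m′))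
    (stable : NStable n f) where

  open Residues m′ n cop

  r : ℕ
  r = suc r′

  InWindow : ℤ → Set
  InWindow y = + 1 ≤ f y × f y ≤ + r

  same-window⇒same-point : ∀ {y x} c → y ≡ x + c * + m → InWindow y → InWindow x → c ≡ + 0
  same-window⇒same-point {y} {x} c y≡ (1≤fy , fy≤r) (1≤fx , fx≤r) =
    window-offset-zero c 1≤fy fy≤r 1≤fx fx≤r (trans (cong f y≡) (periodic-ℤ f periodic x c))

  level : ℤ → ℤ
  level t = (f t - + 1) /ℕ r

  label : ℤ → ℕ
  label t = suc ((f t - + 1) %ℕ r)

  lower : ℤ → ℤ
  lower t = t + (- level t) * + m

  f-lower : ∀ t → f (lower t) ≡ + label t
  f-lower t = begin
    f (t + (- level t) * + m)                            ≡⟨ periodic-ℤ f periodic t (- level t) ⟩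
    f t + (- level t) * + r                              ≡⟨ cong (λ v → v + (- level t) * + r) (unshift (f t)) ⟩
    f t - + 1 + + 1 + (- level t) * + r                  ≡⟨ cong (λ v → v + + 1 + (- level t) * + r) (a≡a%ℕn+[a/ℕn]*n (f t - + 1) r) ⟩
    + ((f t - + 1) %ℕ r) + level t * + r + + 1 + (- level t) * + r ≡⟨ cancel (+ ((f t - + 1) %ℕ r)) (level t) (+ r) ⟩
    + 1 + + ((f t - + 1) %ℕ r)                           ∎
    where
    open ≡-Reasoning
    unshift : ∀ v → v ≡ v - + 1 + + 1
    unshift = solve-∀
    cancel : ∀ x d r → x + d * r + + 1 + (- d) * r ≡ + 1 + x
    cancel = solve-∀

  label≤r : ∀ t → label t ℕ.≤ r
  label≤r t = n%ℕd<d (f t - + 1) r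

  lower-in-window : ∀ t → InWindow (lower t)
  lower-in-window t = subst (λ v → + 1 ≤ v × v ≤ + r) (sym (f-lower t)) (+≤+ (s≤s z≤n) , +≤+ (label≤r t))

  private
    μ-data : Σ ℤ λ μ → μ ∈ L × (∀ {y} → y ∈ L → μ ≤ y)
    μ-data = minimum L (subst (0 ℕ.<_) (sym #L) (s≤s z≤n))

  μ : ℤ
  μ = proj₁ μ-data

  μ-in-window : InWindow μ
  μ-in-window = Equivalence.from (∈L⇔ μ) (proj₁ (proj₂ μ-data))

  k : ℤ
  k = - μ

  z : ℕ → ℤ
  z j = lower (+ n * + j - k)

  d : ℕ → ℤ
  d j = level (+ n * + j - k)

  Υ′ : ℕ → ℕ
  Υ′ j = label (+ n * + j - k)

  z≡ : ∀ j → z j ≡ + n * + j + (- d j) * + m - k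
  z≡ j = swap-last (+ n * + j) k (- d j) (+ m)
    where
    swap-last : ∀ x k e m → x - k + e * m ≡ x + e * m - k
    swap-last = solve-∀

  f-z : ∀ j → f (z j) ≡ + Υ′ j
  f-z j = f-lower (+ n * + j - k)

  d-zero : d 0 ≡ + 0
  d-zero = ℤP.neg-injective (same-window⇒same-point (- d 0) (trans (z≡ 0) (at-zero (+ n) (d 0) (+ m) μ))
             (lower-in-window (+ n * + 0 - k)) μ-in-window)
    where
    at-zero : ∀ n d m μ → n * + 0 + (- d) * m - (- μ) ≡ μ + (- d) * m
    at-zero = solve-∀

  d-last : d m ≡ + n
  d-last = move (same-window⇒same-point (+ n - d m) (trans (z≡ m) (at-m (+ n) (d m) (+ m) μ))
             (lower-in-window (+ n * + m - k)) μ-in-window)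
    where
    at-m : ∀ n d m μ → n * m + (- d) * m - (- μ) ≡ μ + (n - d) * m
    at-m = solve-∀
    move : + n - d m ≡ + 0 → d m ≡ + n
    move e = trans (balance (d m) (+ n)) (trans (cong (λ δ → + n - δ) e) (ℤP.+-identityʳ (+ n)))
      where
      balance : ∀ d n → d ≡ n - (n - d)
      balance = solve-∀

  label-step : ∀ j → + Υ′ j ≤ + Υ′ (suc j) + (d (suc j) - d j) * + r
  label-step j = begin
    + Υ′ j                                     ≡⟨ f-z j ⟨
    f (z j)                                    ≤⟨ stable (z j) ⟩
    f (z j + + n)                              ≡⟨ cong f (trans (cong (_+ + n) (z≡ j)) (trans (next (+ n) (+ j) (d j) (d (suc j)) (+ m) k)
                                                    (cong (_+ (d (suc j) - d j) * + m) (sym (z≡ (suc j)))))) ⟩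
    f (z (suc j) + (d (suc j) - d j) * + m)    ≡⟨ periodic-ℤ f periodic (z (suc j)) (d (suc j) - d j) ⟩
    f (z (suc j)) + (d (suc j) - d j) * + r    ≡⟨ cong (_+ (d (suc j) - d j) * + r) (f-z (suc j)) ⟩
    + Υ′ (suc j) + (d (suc j) - d j) * + r     ∎
    where
    open ℤP.≤-Reasoning
    next : ∀ n j d d′ m k → n * j + (- d) * m - k + n ≡ n * (+ 1 + j) + (- d′) * m - k + (d′ - d) * m
    next = solve-∀

  d-mono : ∀ j → d j ≤ d (suc j)
  d-mono j = ℤP.0≤i-j⇒j≤i
    (window-offset-nonneg (d (suc j) - d j) (+≤+ (s≤s z≤n)) (+≤+ (label≤r (+ n * + suc j - k))) (label-step j))

  d-nonneg : ∀ j → + 0 ≤ d j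
  d-nonneg zero    = ℤP.≤-reflexive (sym d-zero)
  d-nonneg (suc j) = ℤP.≤-trans (d-nonneg j) (d-mono j)

  A : ℕ → ℕ
  A j = ∣ d j ∣

  +A≡d : ∀ j → + A j ≡ d j
  +A≡d j = ℤP.0≤i⇒+∣i∣≡i (d-nonneg j)

  A-mono : ∀ j → A j ℕ.≤ A (suc j)
  A-mono j = ℤP.drop‿+≤+ (subst₂ _≤_ (sym (+A≡d j)) (sym (+A≡d (suc j))) (d-mono j))

  A-last : A m ≡ n
  A-last = ℤP.+-injective (trans (+A≡d m) d-last)

  below-line : ∀ j → m ℕ.* A j ℕ.≤ n ℕ.* j
  below-line j = ℤP.drop‿+≤+ (subst₂ _≤_ (sym (ℤP.pos-* m (A j))) (sym (ℤP.pos-* n j))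
    (ℤP.0≤i-j⇒j≤i (subst (+ 0 ≤_) z-μ≡ (ℤP.i≤j⇒0≤j-i (proj₂ (proj₂ μ-data) z∈L)))))
    where
    z∈L : z j ∈ L
    z∈L = Equivalence.to (∈L⇔ (z j)) (lower-in-window (+ n * + j - k))
    difference : ∀ n j a m μ → n * j + (- a) * m - (- μ) - μ ≡ n * j - m * a
    difference = solve-∀
    z-μ≡ : z j - μ ≡ + n * + j - + m * + A j
    z-μ≡ = trans (cong (_- μ) (trans (z≡ j) (cong (λ δ → + n * + j + (- δ) * + m - k) (sym (+A≡d j)))))
                 (difference (+ n) (+ j) (+ A j) (+ m) μ)

  path′ : List Step
  path′ = staircase 0 m A n

  eastBefore-path′ : ∀ j → j ℕ.< m → eastBefore path′ j ≡ A j
  eastBefore-path′ j j<m = trans (sym (ℕP.+-identityʳ _)) (eastBefore-staircase 0 m A n A-mono z≤n j j<m)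

  path′-isDyck : IsDyck m n path′
  path′-isDyck = IsDyck-intro m n path′ (countS-staircase 0 m A n)
    (trans (sym (ℕP.+-identityʳ _)) (countE-staircase 0 m A n A-mono z≤n (ℕP.≤-reflexive A-last)))
    (λ j j<m → subst (λ a → m ℕ.* a ℕ.≤ n ℕ.* j) (sym (eastBefore-path′ j j<m)) (below-line j))

  Υ′-mono : ∀ (i j : Fin m) → toℕ j ≡ suc (toℕ i) → eastBefore path′ (toℕ i) ≡ eastBefore path′ (toℕ j) →
            Υ′ (toℕ i) ℕ.≤ Υ′ (toℕ j)
  Υ′-mono i j j≡i+1 same = subst (λ t → Υ′ (toℕ i) ℕ.≤ Υ′ t) (sym j≡i+1) (ℤP.drop‿+≤+ (begin
    + Υ′ (toℕ i)                                                    ≤⟨ label-step (toℕ i) ⟩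
    + Υ′ (suc (toℕ i)) + (d (suc (toℕ i)) - d (toℕ i)) * + r        ≡⟨ cong (λ δ → + Υ′ (suc (toℕ i)) + δ * + r) no-rise ⟩
    + Υ′ (suc (toℕ i)) + + 0 * + r                                  ≡⟨ ℤP.+-identityʳ _ ⟩
    + Υ′ (suc (toℕ i))                                              ∎))
    where
    open ℤP.≤-Reasoning
    A≡ : A (toℕ i) ≡ A (suc (toℕ i))
    A≡ = trans (sym (eastBefore-path′ (toℕ i) (FP.toℕ<n i)))
           (trans same (trans (eastBefore-path′ (toℕ j) (FP.toℕ<n j)) (cong A j≡i+1)))
    no-rise : d (suc (toℕ i)) - d (toℕ i) ≡ + 0
    no-rise = trans (cong₂ _-_ (sym (+A≡d (suc (toℕ i)))) (sym (+A≡d (toℕ i))))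
                (trans (cong (λ a → + a - + A (toℕ i)) (sym A≡)) (ℤP.+-inverseʳ (+ A (toℕ i))))

  P : SSPF m n r
  P = record
    { path    = path′
    ; isDyck  = path′-isDyck
    ; Υ       = Υ′ ∘ toℕ
    ; Υ-range = λ j → s≤s z≤n , label≤r (+ n * + toℕ j - k)
    ; Υ-mono  = Υ′-mono
    }

  f-spec : ∀ j q → f (+ n * + toℕ j + q * + m - k) ≡ + Υ P j + (q + + aCoord P j) * + r
  f-spec j q = begin
    f (+ n * + toℕ j + q * + m - k)              ≡⟨ cong f (regroup (+ n * + toℕ j) q (d (toℕ j)) (+ m) k) ⟩
    f (+ n * + toℕ j + (- d (toℕ j)) * + m - k + (q + d (toℕ j)) * + m) ≡⟨ cong (λ x → f (x + (q + d (toℕ j)) * + m)) (z≡ (toℕ j)) ⟨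
    f (z (toℕ j) + (q + d (toℕ j)) * + m)        ≡⟨ periodic-ℤ f periodic (z (toℕ j)) (q + d (toℕ j)) ⟩
    f (z (toℕ j)) + (q + d (toℕ j)) * + r        ≡⟨ cong₂ (λ v δ → v + (q + δ) * + r) (f-z (toℕ j)) (sym d≡a) ⟩
    + Υ P j + (q + + aCoord P j) * + r           ∎
    where
    open ≡-Reasoning
    regroup : ∀ x q d m k → x + q * m - k ≡ x + (- d) * m - k + (q + d) * m
    regroup = solve-∀
    d≡a : + aCoord P j ≡ d (toℕ j)
    d≡a = trans (cong +_ (eastBefore-path′ (toℕ j) (FP.toℕ<n j))) (+A≡d (toℕ j))

  open LabelledFunction m′ n cop r (aCoord P) (Υ P) (Υ-range P) k f f-spec

  windows↭L : windows ↭ L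
  windows↭L = same-members⇒↭ windows L
    (AllPairs.map DistinctMod⇒≢ windows-distinct) (AllPairs.map DistinctMod⇒≢ L-distinct)
    (λ {x} x∈ → Equivalence.to (∈L⇔ x) (Equivalence.from (∈-windows⇔ x) x∈))
    (λ {x} x∈ → Equivalence.to (∈-windows⇔ x) (Equivalence.from (∈L⇔ x) x∈))

  k-spec : + m * k ≡ sumℤ (map (λ j → γv P j - + suc (toℕ j)) (allFin m))
  k-spec = trans (Equivalence.from (sumFin-shift⇔ (γv P) k) (ℤP.*-cancelˡ-≡ (+ 2) _ _ (begin
    + 2 * sumFin (λ j → γv P j - k)          ≡⟨ cong (+ 2 *_) (sumFin-cong (λ j → cong (_- k) (γv≡window-form P j))) ⟩
    + 2 * sumFin window                      ≡⟨ cong (+ 2 *_) (sumℤ-map-allFin window) ⟨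
    + 2 * sumℤ windows                       ≡⟨ cong (+ 2 *_) (sumℤ-↭ windows↭L) ⟩
    + 2 * sumℤ L                             ≡⟨ ΣL ⟩
    + m * + suc m                            ≡⟨ sumFin-suc-toℕ m ⟨
    + 2 * sumFin {m} (λ j → + suc (toℕ j))   ∎)))
    (sym (sumℤ-map-allFin (λ j → γv P j - + suc (toℕ j))))
    where open ≡-Reasoning

  isA : IsA P f
  isA = k , k-spec , f-spec⇒IsA-spec P f k f-spec

  weight : ∀ {w} → HasWeight f w → ∀ i → sspfWeight P i ≡ w i
  weight hw = HasWeight-unique (hasWeight (sspfWeight P) (λ _ → refl)) hw

mainTheorem4 :
    (m n r : ℕ) → 1 ℕ.≤ m → 1 ℕ.≤ n → 1 ℕ.≤ r → Coprime m n →
    (w : Fin r → ℕ) → sum (map w (allFin r)) ≡ m →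
    -- well-defined (f̃ and k exist and determine f uniquely), lands in the
    -- n-stable (m,r)-affine compositions, and is weight preserving
    ((P : SSPF m n r) → (∀ i → sspfWeight P i ≡ w i) →
      Σ[ f ∈ (ℤ → ℤ) ]
        ( IsA P f
        × (∀ g → IsA P g → ∀ x → f x ≡ g x)
        × IsAffineComp m r f × NStable n f × HasWeight f w ))
    -- injective
    × ((P Q : SSPF m n r) → (∀ i → sspfWeight P i ≡ w i) → (∀ i → sspfWeight Q i ≡ w i) →
       (f g : ℤ → ℤ) → IsA P f → IsA Q g → (∀ x → f x ≡ g x) → P ≈SSPF Q)
    -- surjective onto n-stable affine compositions of weight w
    × ((f : ℤ → ℤ) → IsAffineComp m r f → NStable n f → HasWeight f w →
       Σ[ P ∈ SSPF m n r ] ((∀ i → sspfWeight P i ≡ w i) × IsA P f))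
mainTheorem4 zero     _ _        ()  _   _ _   _ _
mainTheorem4 (suc _)  _ zero     _   _   () _  _ _
mainTheorem4 (suc m′) n (suc r′) _   1≤n _ cop w _ =
  (λ P weight-P → let open Forward m′ n cop 1≤n P in f , isA , isA-unique , affine , stable , weight w weight-P) ,
  (λ P Q _ _ → Injectivity.injective m′ n cop P Q) ,
  λ { f (periodic , L , #L , L-distinct , ∈L⇔ , ΣL) stable weight-f →
        let open Surjectivity m′ n cop r′ f periodic L #L L-distinct ∈L⇔ ΣL stable in P , weight weight-f , isA }
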